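{- Let $f(x)=\alpha x+\beta$ and $g(x)=x+\gamma$ with $\beta,\gamma\in\mathbb{C}$ and $\alpha\in\overline{\mathbb{Q}}^*$. Then the semigroup generated by $f$ and $g$ under composition is not free.
   Context: "Free" means isomorphic to the free semigroup on the two generators $f,g$, i.e. distinct words in $f,g$ give distinct compositions. -}

module Defs where

open import Level using (_⊔_)
open import Algebra.Bundles using (CommutativeRing)
open import Data.Nat using (ℕ; zero; suc)
open import Data.Integer using (ℤ; +_; -[1+_])
open import Data.List using (List; []; _∷_)
open import Data.List.NonEmpty using (List⁺; _∷_)
open import Data.List.Relation.Unary.Any using (Any)
open import Data.Product using (Σ; ∃; _×_; _,_)
open import Relation.Nullary using (¬_)
open import Relation.Binary.PropositionalEquality using (_≡_; _≢_)

data Gen : Set where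
  𝒇 𝒈 : Gen

module _ {c ℓ} (R : CommutativeRing c ℓ) where
  open CommutativeRing R

  fromℕ : ℕ → Carrier
  fromℕ zero    = 0#
  fromℕ (suc n) = 1# + fromℕ n

  fromℤ : ℤ → Carrier
  fromℤ (+ n)    = fromℕ n
  fromℤ -[1+ n ] = - fromℕ (suc n)

  -- R is a field of characteristic zero (the paper's ℂ is abstracted to
  -- an arbitrary such field)
  record IsChar0Field : Set (c ⊔ ℓ) where
    field
      1≉0     : ¬ (1# ≈ 0#)
      inverse : ∀ x → ¬ (x ≈ 0#) → Σ Carrier (λ y → (x * y) ≈ 1#)
      char0   : ∀ n → ¬ (fromℕ (suc n) ≈ 0#)

  -- evaluation of an integer polynomial given by its coefficient list
  -- c₀ ∷ c₁ ∷ … (lowest degree first)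
  evalPoly : List ℤ → Carrier → Carrier
  evalPoly []       x = 0#
  evalPoly (k ∷ ks) x = fromℤ k + x * evalPoly ks x

  -- α is algebraic over ℚ: a root of a nonzero polynomial with integer
  -- coefficients (equivalent to rational coefficients by clearing denominators)
  IsAlgebraic : Carrier → Set ℓ
  IsAlgebraic α = ∃ λ (ks : List ℤ) → Any (λ k → k ≢ + 0) ks × (evalPoly ks α ≈ 0#)

  affine : Carrier → Carrier → Carrier → Carrier
  affine α β x = α * x + β

  translate : Carrier → Carrier → Carrier
  translate γ x = x + γ

  -- composition along a nonempty word: h₁ h₂ … hₖ ↦ h₁ ∘ h₂ ∘ … ∘ hₖ
  evalWord : (Carrier → Carrier) → (Carrier → Carrier) → List⁺ Gen → Carrier → Carrier
  evalWord f g (h ∷ hs) x = go h hs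
    where
    gen : Gen → Carrier → Carrier
    gen 𝒇 = f
    gen 𝒈 = g
    go : Gen → List Gen → Carrier
    go h₀ []        = gen h₀ x
    go h₀ (h₁ ∷ rest) = gen h₀ (go h₁ rest)

  IsFree : (Carrier → Carrier) → (Carrier → Carrier) → Set (c ⊔ ℓ)
  IsFree f g = ∀ (w₁ w₂ : List⁺ Gen) →
    (∀ x → evalWord f g w₁ x ≈ evalWord f g w₂ x) → w₁ ≡ w₂

{-# OPTIONS --safe #-}
module Submission where

open import Defs
open import Algebra.Bundles using (CommutativeRing)
open import Relation.Nullary using (¬_)
open import Data.Maybe using (nothing)
open import Data.Nat using (ℕ; zero; suc)
open import Data.Integer using (ℤ; +_; -[1+_])
open import Data.List using (List; []; _∷_; _++_; replicate; map; length)
open import Data.List.Properties using (∷-injectiveˡ; ∷-injectiveʳ; length-map)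
open import Data.List.NonEmpty using (_∷_)
import Data.List.NonEmpty as List⁺
open import Data.List.Relation.Unary.Any using (Any; here; there)
open import Data.Product using (_×_; _,_)
open import Function.Definitions using (Injective)
open import Relation.Binary.PropositionalEquality using (_≡_; _≢_; refl; cong; sym; trans)
open import Tactic.RingSolver using (solve-∀)
open import Tactic.RingSolver.Core.AlmostCommutativeRing using (AlmostCommutativeRing; fromCommutativeRing)
import Relation.Binary.Reasoning.Setoid as SetoidReasoning

-- An integer polynomial P with P(α) = 0 splits as P = P⁺ − P⁻, where P⁺ ≠ P⁻
-- have natural coefficients and the same length n.  The word
-- g^p₀ f g^p₁ f ⋯ g^pₙ₋₁ f composes to x ↦ αⁿ x + cₙ + γ (p₀ + p₁ α + ⋯ + pₙ₋₁ αⁿ⁻¹)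
-- with cₙ depending only on n, so the words read off P⁺ and P⁻ are distinct but
-- give the same map.

positivePart : ℤ → ℕ
positivePart (+ n)    = n
positivePart -[1+ n ] = 0

negativePart : ℤ → ℕ
negativePart (+ n)    = 0
negativePart -[1+ n ] = suc n

positivePart≡negativePart⇒≡0 : ∀ k → positivePart k ≡ negativePart k → k ≡ + 0
positivePart≡negativePart⇒≡0 (+ n)    eq = cong +_ eq
positivePart≡negativePart⇒≡0 -[1+ n ] ()

map-positivePart≢map-negativePart : ∀ {ks} → Any (_≢ + 0) ks →
  map positivePart ks ≢ map negativePart ks
map-positivePart≢map-negativePart {k ∷ _} (here k≢0) eq =
  k≢0 (positivePart≡negativePart⇒≡0 k (∷-injectiveˡ eq))
map-positivePart≢map-negativePart (there nonzero) eq =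
  map-positivePart≢map-negativePart nonzero (∷-injectiveʳ eq)

gᵖf : ℕ → List Gen → List Gen
gᵖf p w = replicate p 𝒈 ++ 𝒇 ∷ w

gᵖf-injective : ∀ p q {u v} → gᵖf p u ≡ gᵖf q v → p ≡ q × u ≡ v
gᵖf-injective zero    zero    eq = refl , ∷-injectiveʳ eq
gᵖf-injective (suc p) (suc q) eq with gᵖf-injective p q (∷-injectiveʳ eq)
... | refl , u≡v = refl , u≡v

encode : List ℕ → List Gen
encode []       = []
encode (p ∷ ps) = gᵖf p (encode ps)

encode-injective : Injective _≡_ _≡_ encode
encode-injective {[]}        {[]}        _  = refl
encode-injective {[]}        {zero  ∷ _} ()
encode-injective {[]}        {suc _ ∷ _} ()
encode-injective {zero  ∷ _} {[]}        ()
encode-injective {suc _ ∷ _} {[]}        ()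
encode-injective {p ∷ ps}    {q ∷ qs}    eq with gᵖf-injective p q eq
... | refl , eq′ = cong (p ∷_) (encode-injective eq′)

module _ {c ℓ} (K : CommutativeRing c ℓ) where

  ring : AlmostCommutativeRing c ℓ
  ring = fromCommutativeRing K (λ _ → nothing)

  open AlmostCommutativeRing ring hiding (sym; trans) renaming (refl to ≈-refl)
  open SetoidReasoning setoid

  fromℤ-+-negativePart : ∀ k → fromℤ K k + fromℕ K (negativePart k) ≈ fromℕ K (positivePart k)
  fromℤ-+-negativePart (+ n)    = +-identityʳ _
  fromℤ-+-negativePart -[1+ n ] = CommutativeRing.-‿inverseˡ K _

  module _ (α : Carrier) where

    evalℕPoly : List ℕ → Carrier
    evalℕPoly ps = evalPoly K (map +_ ps) α

    evalPoly-+-negativePart : ∀ ks →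
      evalPoly K ks α + evalℕPoly (map negativePart ks) ≈ evalℕPoly (map positivePart ks)
    evalPoly-+-negativePart []       = +-identityʳ 0#
    evalPoly-+-negativePart (k ∷ ks) = begin
      (fromℤ K k + α * P) + (fromℕ K (negativePart k) + α * P⁻) ≈⟨ regroup α _ P _ P⁻ ⟩
      (fromℤ K k + fromℕ K (negativePart k)) + α * (P + P⁻)
        ≈⟨ +-cong (fromℤ-+-negativePart k) (*-cong ≈-refl (evalPoly-+-negativePart ks)) ⟩
      fromℕ K (positivePart k) + α * evalℕPoly (map positivePart ks) ∎
      where
      P  = evalPoly K ks α
      P⁻ = evalℕPoly (map negativePart ks)
      regroup : ∀ x a e b d → (a + x * e) + (b + x * d) ≈ (a + b) + x * (e + d)
      regroup = solve-∀ ring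

    evalℕPoly-positivePart≈negativePart : ∀ ks → evalPoly K ks α ≈ 0# →
      evalℕPoly (map positivePart ks) ≈ evalℕPoly (map negativePart ks)
    evalℕPoly-positivePart≈negativePart ks root = begin
      evalℕPoly (map positivePart ks)                   ≈˘⟨ evalPoly-+-negativePart ks ⟩
      evalPoly K ks α + evalℕPoly (map negativePart ks) ≈⟨ +-cong root ≈-refl ⟩
      0# + evalℕPoly (map negativePart ks)              ≈⟨ +-identityˡ _ ⟩
      evalℕPoly (map negativePart ks)                   ∎

  module _ (α β γ : Carrier) where

    private
      f g : Carrier → Carrier
      f = affine K α β
      g = translate K γ

    ⟦_⟧ : Gen → Carrier → Carrier
    ⟦ 𝒇 ⟧ = f
    ⟦ 𝒈 ⟧ = g

    compose : List Gen → Carrier → Carrier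
    compose []       x = x
    compose (h ∷ hs) x = ⟦ h ⟧ (compose hs x)

    evalWord≡compose : ∀ h hs x → evalWord K f g (h ∷ hs) x ≡ compose (h ∷ hs) x
    evalWord≡compose 𝒇 []        x = refl
    evalWord≡compose 𝒈 []        x = refl
    evalWord≡compose 𝒇 (h ∷ hs) x = cong f (evalWord≡compose h hs x)
    evalWord≡compose 𝒈 (h ∷ hs) x = cong g (evalWord≡compose h hs x)

    compose-++ : ∀ u v x → compose (u ++ v) x ≡ compose u (compose v x)
    compose-++ []      v x = refl
    compose-++ (h ∷ u) v x = cong ⟦ h ⟧ (compose-++ u v x)

    compose-replicate-𝒈 : ∀ p x → compose (replicate p 𝒈) x ≈ x + fromℕ K p * γ
    compose-replicate-𝒈 zero    x = begin
      x           ≈˘⟨ +-identityʳ x ⟩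
      x + 0#      ≈˘⟨ +-cong ≈-refl (zeroˡ γ) ⟩
      x + 0# * γ  ∎
    compose-replicate-𝒈 (suc p) x = begin
      compose (replicate p 𝒈) x + γ ≈⟨ +-cong (compose-replicate-𝒈 p x) ≈-refl ⟩
      (x + n * γ) + γ              ≈⟨ swap x n γ ⟩
      x + (γ + n * γ)              ≈˘⟨ +-cong ≈-refl (+-cong (*-identityˡ γ) ≈-refl) ⟩
      x + (1# * γ + n * γ)         ≈˘⟨ +-cong ≈-refl (distribʳ γ 1# n) ⟩
      x + (1# + n) * γ             ∎
      where
      n = fromℕ K p
      swap : ∀ x n y → (x + n * y) + y ≈ x + (y + n * y)
      swap = solve-∀ ring

    compose-gᵖf : ∀ p w x → compose (gᵖf p w) x ≈ f (compose w x) + fromℕ K p * γ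
    compose-gᵖf p w x = begin
      compose (gᵖf p w) x                    ≡⟨ compose-++ (replicate p 𝒈) (𝒇 ∷ w) x ⟩
      compose (replicate p 𝒈) (f (compose w x)) ≈⟨ compose-replicate-𝒈 p _ ⟩
      f (compose w x) + fromℕ K p * γ        ∎

    compose-encode : ∀ ps x →
      compose (encode ps) x ≈ compose (encode (replicate (length ps) 0)) x + γ * evalℕPoly α ps
    compose-encode []       x = begin
      x           ≈˘⟨ +-identityʳ x ⟩
      x + 0#      ≈˘⟨ +-cong ≈-refl (zeroʳ γ) ⟩
      x + γ * 0#  ∎
    compose-encode (p ∷ ps) x = begin
      compose (gᵖf p (encode ps)) x       ≈⟨ compose-gᵖf p (encode ps) x ⟩
      (α * compose (encode ps) x + β) + n * γ
        ≈⟨ +-cong (+-cong (*-cong ≈-refl (compose-encode ps x)) ≈-refl) ≈-refl ⟩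
      (α * (z + γ * P) + β) + n * γ       ≈⟨ shift α β γ z P n ⟩
      (α * z + β) + γ * (n + α * P)       ≡⟨⟩
      compose (gᵖf 0 (encode zeros)) x + γ * evalℕPoly α (p ∷ ps) ∎
      where
      n = fromℕ K p
      P = evalℕPoly α ps
      zeros = replicate (length ps) 0
      z = compose (encode zeros) x
      shift : ∀ a b c y e m → (a * (y + c * e) + b) + m * c ≈ (a * y + b) + c * (m + a * e)
      shift = solve-∀ ring

    compose-encode-cong : ∀ {ps qs} → length ps ≡ length qs → evalℕPoly α ps ≈ evalℕPoly α qs →
      ∀ x → compose (encode ps) x ≈ compose (encode qs) x
    compose-encode-cong {ps} {qs} len≡ P≈Q x = begin
      compose (encode ps) x                   ≈⟨ compose-encode ps x ⟩
      zeros (length ps) + γ * evalℕPoly α ps  ≡⟨ cong (λ n → zeros n + γ * evalℕPoly α ps) len≡ ⟩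
      zeros (length qs) + γ * evalℕPoly α ps  ≈⟨ +-cong ≈-refl (*-cong ≈-refl P≈Q) ⟩
      zeros (length qs) + γ * evalℕPoly α qs  ≈˘⟨ compose-encode qs x ⟩
      compose (encode qs) x                   ∎
      where
      zeros : ℕ → Carrier
      zeros n = compose (encode (replicate n 0)) x

    evalℕPoly-collision⇒¬IsFree : ∀ {ps qs} → ps ≢ qs → length ps ≡ length qs →
      evalℕPoly α ps ≈ evalℕPoly α qs → ¬ IsFree K f g
    evalℕPoly-collision⇒¬IsFree {ps} {qs} ps≢qs len≡ P≈Q free =
      ps≢qs (encode-injective (cong List⁺.tail (free (𝒇 ∷ encode ps) (𝒇 ∷ encode qs) agree)))
      where
      agree : ∀ x → evalWord K f g (𝒇 ∷ encode ps) x ≈ evalWord K f g (𝒇 ∷ encode qs) x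
      agree x = begin
        evalWord K f g (𝒇 ∷ encode ps) x ≡⟨ evalWord≡compose 𝒇 (encode ps) x ⟩
        f (compose (encode ps) x)
          ≈⟨ +-cong (*-cong ≈-refl (compose-encode-cong {ps} {qs} len≡ P≈Q x)) ≈-refl ⟩
        f (compose (encode qs) x)        ≡˘⟨ evalWord≡compose 𝒇 (encode qs) x ⟩
        evalWord K f g (𝒇 ∷ encode qs) x ∎

proposition2p13 : ∀ {c ℓ} (K : CommutativeRing c ℓ) → IsChar0Field K →
    (α β γ : CommutativeRing.Carrier K) →
    IsAlgebraic K α → ¬ (CommutativeRing._≈_ K α (CommutativeRing.0# K)) →
    ¬ IsFree K (affine K α β) (translate K γ)
proposition2p13 K _ α β γ (ks , nonzero , root) _ =
  evalℕPoly-collision⇒¬IsFree K α β γ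
    (map-positivePart≢map-negativePart nonzero)
    (trans (length-map positivePart ks) (sym (length-map negativePart ks)))
    (evalℕPoly-positivePart≈negativePart K α ks root)
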